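{- Let $N$ be an odd positive integer with $\sigma^*(\sigma^*(N))=2N$ and $N\neq 9,165$. Then $\omega(N)\ge 3$.
   Context: $\sigma^*(n)$ is the sum of the unitary divisors of $n$, i.e. divisors $d$ of $n$ with $\gcd(d,n/d)=1$. $\omega(N)$ denotes the number of distinct prime factors of $N$. -}

module Defs where

open import Data.Nat using (ℕ; suc; _∸_)
open import Data.Nat.DivMod using (_/_)
open import Data.Nat.Divisibility using (_∣_; _∣?_)
open import Data.Nat.Coprimality using (Coprime; coprime?)
open import Data.Nat.Primality using (Prime; prime?)
open import Data.Nat.ListAction using (sum)
open import Data.List using (List; filter; map; length; upTo)
open import Data.Product using (_×_)
open import Relation.Nullary using (Dec)
open import Relation.Nullary.Decidable using (_×-dec_)

candidates : ℕ → List ℕ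
candidates n = map suc (upTo n)

-- d is a unitary divisor of n: d ∣ n and gcd(d, n/d) = 1.
-- (Only applied to d ≥ 1; the divisor is written suc (d ∸ 1) = d to satisfy NonZero.)
UnitaryDivisor : ℕ → ℕ → Set
UnitaryDivisor n d = d ∣ n × Coprime d (n / suc (d ∸ 1))

unitaryDivisor? : (n d : ℕ) → Dec (UnitaryDivisor n d)
unitaryDivisor? n d = (d ∣? n) ×-dec coprime? d (n / suc (d ∸ 1))

-- σ*(n) : sum of the unitary divisors of n (σ*(0) = 0; irrelevant here)
σ* : ℕ → ℕ
σ* n = sum (filter (unitaryDivisor? n) (candidates n))

-- ω(n) : number of distinct primes dividing n, for n ≥ 1
-- (every prime divisor of n ≥ 1 lies in 1..n)
PrimeDivisor : ℕ → ℕ → Set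
PrimeDivisor n p = Prime p × p ∣ n

ω : ℕ → ℕ
ω n = length (filter (λ p → prime? p ×-dec (p ∣? n)) (candidates n))

-- σ* is multiplicative, and every n ≥ 2 either splits as a product of two coprime
-- factors ≥ 2 or has σ*(n) = n + 1; hence σ*(n) is even for odd n ≥ 2, and divisible
-- by 4 when n splits. If σ*(M) = 2N with M even and N odd, write M = 2^k m with m odd:
-- then 2N = (2^k + 1) σ*(m) forces σ*(m) = m + 1 and m ≥ 5. Now take M = σ*(N) and
-- suppose ω(N) ≤ 2. If N does not split, M = N + 1 and (2^k + 1)(m + 1) = 2N leave
-- only N = 9. Otherwise N = u v with σ*(u) = u + 1, σ*(v) = v + 1, so M = (u + 1)(v + 1)
-- and 4 ∣ 2^k; the two equations (u + 1)(v + 1) = 2^k m and (2^k + 1)(m + 1) = 2uv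
-- bound u, v ≤ 10, and the remaining cases are excluded by computation.

module Submission where

open import Defs
open import Data.Nat
open import Data.Nat.Properties
open import Data.Nat.Divisibility
open import Data.Nat.DivMod using (m*n/n≡m; m≡m%n+[m/n]*n; m%n<n)
open import Data.Nat.Induction using (<-rec)
open import Data.Nat.GCD using (gcd; GCD; gcd-GCD; GCD-*; gcd[m,n]∣m; gcd[m,n]∣n; gcd[m,n]≢0)
open import Data.Nat.Coprimality as Coprime using (Coprime; coprime-divisor)
open import Data.Nat.ListAction using (sum; product)
open import Data.Nat.ListAction.Properties using (sum-++; sum-↭)
open import Data.Nat.Primality using (Prime; prime?; prime⇒nonTrivial)
open import Data.Nat.Primality.Factorisation using (factorise)
open import Data.Fin as Fin using (Fin)
open import Data.Fin.Patterns using (0F; 1F; 2F)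
open import Data.Fin.Properties using (injective⇒≤)
open import Data.List using (List; []; _∷_; _++_; map; filter; upTo; length; cartesianProductWith)
open import Data.List.Membership.Propositional using (_∈_; find; lose)
open import Data.List.Membership.Propositional.Properties
open import Data.List.Membership.Propositional.Properties.WithK using (unique∧set⇒bag)
open import Data.List.Relation.Binary.BagAndSetEquality using (∼bag⇒↭)
open import Data.List.Relation.Binary.Disjoint.Propositional using (Disjoint)
open import Data.List.Relation.Unary.All as All using ([]; _∷_)
import Data.List.Relation.Unary.All.Properties as All
open import Data.List.Relation.Unary.Any using (here; there; any?)
open import Data.List.Relation.Unary.Unique.Propositional using (Unique; []; _∷_)
import Data.List.Relation.Unary.Unique.Propositional.Properties as Unique
import Data.List.Membership.Setoid.Properties as SetoidMembership
open import Data.Product using (∃; ∃₂; _×_; _,_; proj₁; proj₂)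
open import Data.Sum using (_⊎_; inj₁; inj₂)
open import Function using (_∘_; flip; case_of_; mk⇔)
open import Function.Definitions using (Injective)
open import Relation.Nullary using (¬_; yes; no; contradiction)
open import Relation.Nullary.Decidable using (_×-dec_; _→-dec_; ¬?; from-yes)
open import Relation.Binary.PropositionalEquality
open import Data.Nat.Tactic.RingSolver using (solve-∀)
open import Algebra.Properties.CommutativeSemigroup *-commutativeSemigroup using (xy∙z≈xz∙y)

infix 4 _∥_

_∥_ : ℕ → ℕ → Set
d ∥ n = ∃ λ e → d * e ≡ n × Coprime d e

∥⇒∣ : ∀ {d n} → d ∥ n → d ∣ n
∥⇒∣ {d} (e , refl , _) = divides e (*-comm d e)

∥-1 : ∀ n → 1 ∥ n
∥-1 n = n , *-identityˡ n , Coprime.1-coprimeTo n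

∥-refl : ∀ n → n ∥ n
∥-refl n = 1 , *-identityʳ n , Coprime.sym (Coprime.1-coprimeTo n)

unitaryDivisor⇒∥ : ∀ {n d} → UnitaryDivisor n (suc d) → suc d ∥ n
unitaryDivisor⇒∥ {d = d} (divides e refl , coprime) =
  e , *-comm (suc d) e , subst (Coprime (suc d)) (m*n/n≡m e (suc d)) coprime

∥⇒unitaryDivisor : ∀ {n d} → suc d ∥ n → UnitaryDivisor n (suc d)
∥⇒unitaryDivisor {d = d} (e , refl , coprime) =
  divides e (*-comm (suc d) e) ,
  subst (Coprime (suc d)) (sym (trans (cong (_/ suc d) (*-comm (suc d) e)) (m*n/n≡m e (suc d)))) coprime

∈-candidates⁺ : ∀ {n d} → 1 ≤ d → d ≤ n → d ∈ candidates n
∈-candidates⁺ {d = suc _} _ d≤n = ∈-map⁺ suc (∈-upTo⁺ d≤n)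

unitaryDivisors : ℕ → List ℕ
unitaryDivisors n = filter (unitaryDivisor? n) (candidates n)

unitaryDivisors-unique : ∀ n → Unique (unitaryDivisors n)
unitaryDivisors-unique n =
  Unique.filter⁺ (unitaryDivisor? n) {candidates n} (Unique.map⁺ suc-injective (Unique.upTo⁺ n))

∈-unitaryDivisors⁻ : ∀ {n d} → d ∈ unitaryDivisors n → d ∥ n
∈-unitaryDivisors⁻ {n} d∈ with ∈-filter⁻ (unitaryDivisor? n) {xs = candidates n} d∈
... | d∈candidates , unitary with ∈-map⁻ suc {xs = upTo n} d∈candidates
... | _ , _ , refl = unitaryDivisor⇒∥ unitary

∈-unitaryDivisors⁺ : ∀ {n d} → 1 ≤ n → d ∥ n → d ∈ unitaryDivisors n
∈-unitaryDivisors⁺ {d = zero} () (_ , refl , _)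
∈-unitaryDivisors⁺ {n} {suc _} 1≤n d∥n =
  ∈-filter⁺ (unitaryDivisor? n) {xs = candidates n} (∈-candidates⁺ z<s (∣⇒≤ {{>-nonZero 1≤n}} (∥⇒∣ d∥n)))
    (∥⇒unitaryDivisor d∥n)

σ*≡sum : ∀ {n xs} → 1 ≤ n → Unique xs →
         (∀ {d} → d ∈ xs → d ∥ n) → (∀ {d} → d ∥ n → d ∈ xs) → σ* n ≡ sum xs
σ*≡sum {n} 1≤n unique ∈xs⇒∥ ∥⇒∈xs =
  sum-↭ (∼bag⇒↭ (unique∧set⇒bag (unitaryDivisors-unique n) unique
    (mk⇔ (∥⇒∈xs ∘ ∈-unitaryDivisors⁻) (∈-unitaryDivisors⁺ 1≤n ∘ ∈xs⇒∥))))

coprime-∣ : ∀ {a b c d} → Coprime a b → c ∣ a → d ∣ b → Coprime c d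
coprime-∣ coprime c∣a d∣b (x∣c , x∣d) = coprime (∣-trans x∣c c∣a , ∣-trans x∣d d∣b)

coprime-* : ∀ {a b c} → Coprime a b → Coprime a c → Coprime a (b * c)
coprime-* coprime-ab coprime-ac (x∣a , x∣bc) =
  coprime-ac (x∣a , coprime-divisor (coprime-∣ coprime-ab x∣a ∣-refl) x∣bc)

coprime-factor-∣ : ∀ {a b d₁ d₂ e₁ e₂} → Coprime a b → d₁ ∣ a → e₂ ∣ b →
                   d₁ * d₂ ≡ e₁ * e₂ → d₁ ∣ e₁
coprime-factor-∣ {d₁ = d₁} {d₂} {e₁} {e₂} coprime d₁∣a e₂∣b eq =
  coprime-divisor (coprime-∣ coprime d₁∣a e₂∣b)
    (subst (d₁ ∣_) (trans eq (*-comm e₁ e₂)) (m∣m*n d₂))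

coprime-factors-unique : ∀ {a b d₁ d₂ e₁ e₂} → Coprime a b → d₁ ∣ a → e₁ ∣ a → d₂ ∣ b → e₂ ∣ b →
                         d₁ * d₂ ≡ e₁ * e₂ → d₁ ≡ e₁ × d₂ ≡ e₂
coprime-factors-unique {d₁ = d₁} {d₂} {e₁} {e₂} coprime d₁∣a e₁∣a d₂∣b e₂∣b eq =
  ∣-antisym (coprime-factor-∣ coprime d₁∣a e₂∣b eq) (coprime-factor-∣ coprime e₁∣a d₂∣b (sym eq)) ,
  ∣-antisym (coprime-factor-∣ (Coprime.sym coprime) d₂∣b e₁∣a eq′)
            (coprime-factor-∣ (Coprime.sym coprime) e₂∣b d₁∣a (sym eq′))
  where
  eq′ : d₂ * d₁ ≡ e₂ * e₁
  eq′ = trans (*-comm d₂ d₁) (trans eq (*-comm e₁ e₂))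

∥-* : ∀ {a b d₁ d₂} → Coprime a b → d₁ ∥ a → d₂ ∥ b → d₁ * d₂ ∥ a * b
∥-* {d₁ = d₁} {d₂} coprime (e₁ , refl , coprime₁) (e₂ , refl , coprime₂) =
  e₁ * e₂ , [m*n]*[o*p]≡[m*o]*[n*p] d₁ d₂ e₁ e₂ ,
  Coprime.sym (coprime-* (Coprime.sym coprime-d₁) (Coprime.sym coprime-d₂))
  where
  coprime-d₁ : Coprime d₁ (e₁ * e₂)
  coprime-d₁ = coprime-* coprime₁ (coprime-∣ coprime (m∣m*n e₁) (n∣m*n d₂))
  coprime-d₂ : Coprime d₂ (e₁ * e₂)
  coprime-d₂ = coprime-* (coprime-∣ (Coprime.sym coprime) (m∣m*n e₂) (n∣m*n d₁)) coprime₂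

∣-coprime-split : ∀ {a b d} → 1 ≤ a → Coprime a b → d ∣ a * b →
                  ∃₂ λ d₁ d₂ → d₁ * d₂ ≡ d × d₁ ∣ a × d₂ ∣ b
∣-coprime-split {a} {b} {d} 1≤a coprime d∣ab =
  g , u , sym d≡gu , gcd[m,n]∣n d a , coprime-divisor coprime-ua′ u∣a′b
  where
  g : ℕ
  g = gcd d a
  instance
    g≢0 : NonZero g
    g≢0 = ≢-nonZero (gcd[m,n]≢0 d a (inj₂ (>⇒≢ 1≤a)))
  u a′ : ℕ
  u = quotient (gcd[m,n]∣m d a)
  a′ = quotient (gcd[m,n]∣n d a)
  d≡ug : d ≡ u * g
  d≡ug = m∣n⇒n≡quotient*m (gcd[m,n]∣m d a)
  a≡a′g : a ≡ a′ * g
  a≡a′g = m∣n⇒n≡quotient*m (gcd[m,n]∣n d a)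
  d≡gu : d ≡ g * u
  d≡gu = trans d≡ug (*-comm u g)
  coprime-ua′ : Coprime u a′
  coprime-ua′ = Coprime.GCD≡1⇒coprime (GCD-* (subst₂ (λ x y → GCD x y (1 * g)) d≡ug a≡a′g
                  (subst (GCD d a) (sym (*-identityˡ g)) (gcd-GCD d a))))
  u∣a′b : u ∣ a′ * b
  u∣a′b = *-cancelʳ-∣ g (subst₂ _∣_ d≡ug (trans (cong (_* b) a≡a′g) (xy∙z≈xz∙y a′ g b)) d∣ab)

∥-coprime-part : ∀ {a b d₁ d₂} → 1 ≤ a → Coprime a b → d₁ * d₂ ∥ a * b → d₁ ∣ a → d₂ ∣ b → d₁ ∥ a
∥-coprime-part {d₁ = zero} 1≤a _ _ 0∣a _ = contradiction (0∣⇒≡0 0∣a) (>⇒≢ 1≤a)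
∥-coprime-part {b = b} {d₁ = d₁@(suc _)} {d₂} _ coprime (e , d₁d₂e≡ab , coprime-d₁d₂e)
               (divides a′ refl) d₂∣b =
  a′ , *-comm d₁ a′ , coprime-d₁a′
  where
  d₂e≡a′b : d₂ * e ≡ a′ * b
  d₂e≡a′b = *-cancelˡ-≡ (d₂ * e) (a′ * b) d₁ (begin
    d₁ * (d₂ * e)  ≡⟨ sym (*-assoc d₁ d₂ e) ⟩
    d₁ * d₂ * e    ≡⟨ d₁d₂e≡ab ⟩
    a′ * d₁ * b    ≡⟨ cong (_* b) (*-comm a′ d₁) ⟩
    d₁ * a′ * b    ≡⟨ *-assoc d₁ a′ b ⟩
    d₁ * (a′ * b)  ∎)
    where open ≡-Reasoning
  coprime-d₁a′ : Coprime d₁ a′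
  coprime-d₁a′ {c} (c∣d₁ , c∣a′) = coprime (∣-trans c∣d₁ (n∣m*n a′) , ∣-trans c∣d₂ d₂∣b)
    where
    c∣d₂ : c ∣ d₂
    c∣d₂ = coprime-divisor (coprime-∣ coprime-d₁d₂e (∣-trans c∣d₁ (m∣m*n d₂)) ∣-refl)
             (subst (c ∣_) (trans (sym d₂e≡a′b) (*-comm d₂ e)) (∣m⇒∣m*n b c∣a′))

∥-split : ∀ {a b d} → 1 ≤ a → 1 ≤ b → Coprime a b → d ∥ a * b →
          ∃₂ λ d₁ d₂ → d₁ ∥ a × d₂ ∥ b × d₁ * d₂ ≡ d
∥-split {a} {b} 1≤a 1≤b coprime d∥ab with ∣-coprime-split 1≤a coprime (∥⇒∣ d∥ab)
... | d₁ , d₂ , refl , d₁∣a , d₂∣b =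
  d₁ , d₂ , ∥-coprime-part 1≤a coprime d∥ab d₁∣a d₂∣b ,
  ∥-coprime-part 1≤b (Coprime.sym coprime) (subst₂ _∥_ (*-comm d₁ d₂) (*-comm a b) d∥ab) d₂∣b d₁∣a ,
  refl

Unique-map⁺ : ∀ {A B : Set} {f : A → B} {xs} →
              (∀ {x y} → x ∈ xs → y ∈ xs → f x ≡ f y → x ≡ y) → Unique xs → Unique (map f xs)
Unique-map⁺ _ [] = []
Unique-map⁺ injective (x∉xs ∷ unique) =
  All.map⁺ (All.tabulate λ y∈ fx≡fy → All.lookup x∉xs y∈ (injective (here refl) (there y∈) fx≡fy)) ∷
  Unique-map⁺ (λ x∈ y∈ → injective (there x∈) (there y∈)) unique

Unique-cartesianProductWith⁺ :
  ∀ {A B C : Set} (f : A → B → C) {xs ys} →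
  (∀ {w x y z} → w ∈ xs → x ∈ xs → y ∈ ys → z ∈ ys → f w y ≡ f x z → w ≡ x × y ≡ z) →
  Unique xs → Unique ys → Unique (cartesianProductWith f xs ys)
Unique-cartesianProductWith⁺ f _ [] _ = []
Unique-cartesianProductWith⁺ f {x ∷ xs} {ys} injective (x∉xs ∷ unique-xs) unique-ys =
  Unique.++⁺ (Unique-map⁺ (λ y∈ z∈ → proj₂ ∘ injective (here refl) (here refl) y∈ z∈) unique-ys)
             (Unique-cartesianProductWith⁺ f (λ w∈ x∈ → injective (there w∈) (there x∈))
                                           unique-xs unique-ys)
             disjoint
  where
  disjoint : Disjoint (map (f x) ys) (cartesianProductWith f xs ys)
  disjoint (v∈map , v∈product) with ∈-map⁻ (f x) v∈map | ∈-cartesianProductWith⁻ f xs ys v∈product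
  ... | y , y∈ , refl | w , z , w∈ , z∈ , fxy≡fwz =
    All.lookup x∉xs w∈ (proj₁ (injective (here refl) (there w∈) y∈ z∈ fxy≡fwz))

sum-map-* : ∀ x ys → sum (map (x *_) ys) ≡ x * sum ys
sum-map-* x [] = sym (*-zeroʳ x)
sum-map-* x (y ∷ ys) = trans (cong (x * y +_) (sum-map-* x ys)) (sym (*-distribˡ-+ x y (sum ys)))

sum-cartesianProductWith-* : ∀ xs ys → sum (cartesianProductWith _*_ xs ys) ≡ sum xs * sum ys
sum-cartesianProductWith-* [] ys = refl
sum-cartesianProductWith-* (x ∷ xs) ys = begin
  sum (map (x *_) ys ++ cartesianProductWith _*_ xs ys)
    ≡⟨ sum-++ (map (x *_) ys) _ ⟩
  sum (map (x *_) ys) + sum (cartesianProductWith _*_ xs ys)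
    ≡⟨ cong₂ _+_ (sum-map-* x ys) (sum-cartesianProductWith-* xs ys) ⟩
  x * sum ys + sum xs * sum ys
    ≡⟨ *-distribʳ-+ (sum ys) x (sum xs) ⟨
  (x + sum xs) * sum ys
    ∎
  where open ≡-Reasoning

σ*-multiplicative : ∀ {a b} → 1 ≤ a → 1 ≤ b → Coprime a b → σ* (a * b) ≡ σ* a * σ* b
σ*-multiplicative {a} {b} 1≤a 1≤b coprime = begin
  σ* (a * b)    ≡⟨ σ*≡sum (*-mono-≤ 1≤a 1≤b) products-unique ∈products⇒∥ ∥⇒∈products ⟩
  sum products  ≡⟨ sum-cartesianProductWith-* (unitaryDivisors a) (unitaryDivisors b) ⟩
  σ* a * σ* b   ∎
  where
  open ≡-Reasoning
  products : List ℕ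
  products = cartesianProductWith _*_ (unitaryDivisors a) (unitaryDivisors b)
  factor∣ : ∀ {m d} → d ∈ unitaryDivisors m → d ∣ m
  factor∣ = ∥⇒∣ ∘ ∈-unitaryDivisors⁻
  products-unique : Unique products
  products-unique = Unique-cartesianProductWith⁺ _*_
    (λ w∈ x∈ y∈ z∈ → coprime-factors-unique coprime (factor∣ w∈) (factor∣ x∈) (factor∣ y∈) (factor∣ z∈))
    (unitaryDivisors-unique a) (unitaryDivisors-unique b)
  ∈products⇒∥ : ∀ {d} → d ∈ products → d ∥ a * b
  ∈products⇒∥ d∈ with ∈-cartesianProductWith⁻ _*_ (unitaryDivisors a) (unitaryDivisors b) d∈
  ... | _ , _ , d₁∈ , d₂∈ , refl = ∥-* coprime (∈-unitaryDivisors⁻ d₁∈) (∈-unitaryDivisors⁻ d₂∈)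
  ∥⇒∈products : ∀ {d} → d ∥ a * b → d ∈ products
  ∥⇒∈products d∥ab with ∥-split 1≤a 1≤b coprime d∥ab
  ... | _ , _ , d₁∥a , d₂∥b , refl =
    ∈-cartesianProductWith⁺ _*_ (∈-unitaryDivisors⁺ 1≤a d₁∥a) (∈-unitaryDivisors⁺ 1≤b d₂∥b)

CoprimeSplit : ℕ → Set
CoprimeSplit n = ∃₂ λ u v → 2 ≤ u × 2 ≤ v × Coprime u v × u * v ≡ n

∥-proper⇒coprimeSplit : ∀ {n d} → d ∥ n → 2 ≤ d → d < n → CoprimeSplit n
∥-proper⇒coprimeSplit {d = d} (0 , refl , _) _ d<d*0 =
  contradiction (subst (d <_) (*-zeroʳ d) d<d*0) n≮0
∥-proper⇒coprimeSplit {d = d} (1 , refl , _) _ d<d*1 =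
  contradiction (subst (d <_) (*-identityʳ d) d<d*1) (<-irrefl refl)
∥-proper⇒coprimeSplit {d = d} (e@(suc (suc _)) , refl , coprime) 2≤d _ =
  d , e , 2≤d , s≤s (s≤s z≤n) , coprime , refl

coprimeSplit⊎σ*≡suc : ∀ {n} → 2 ≤ n → CoprimeSplit n ⊎ σ* n ≡ suc n
coprimeSplit⊎σ*≡suc {n} 2≤n with any? (λ d → 2 ≤? d ×-dec d <? n) (unitaryDivisors n)
... | yes proper with d , d∈ , 2≤d , d<n ← find proper =
  inj₁ (∥-proper⇒coprimeSplit (∈-unitaryDivisors⁻ d∈) 2≤d d<n)
... | no noProper = inj₂ (begin
  σ* n              ≡⟨ σ*≡sum 1≤n ((1≢n ∷ []) ∷ [] ∷ []) ∈[1,n]⇒∥ ∥⇒∈[1,n] ⟩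
  sum (1 ∷ n ∷ [])  ≡⟨ cong suc (+-identityʳ n) ⟩
  suc n             ∎)
  where
  open ≡-Reasoning
  1≤n : 1 ≤ n
  1≤n = <⇒≤ 2≤n
  1≢n : 1 ≢ n
  1≢n = <⇒≢ 2≤n
  ∈[1,n]⇒∥ : ∀ {d} → d ∈ 1 ∷ n ∷ [] → d ∥ n
  ∈[1,n]⇒∥ (here refl) = ∥-1 n
  ∈[1,n]⇒∥ (there (here refl)) = ∥-refl n
  ∥⇒∈[1,n] : ∀ {d} → d ∥ n → d ∈ 1 ∷ n ∷ []
  ∥⇒∈[1,n] {d} d∥n with m≤n⇒m<n∨m≡n (∣⇒≤ {{>-nonZero 1≤n}} (∥⇒∣ d∥n))
  ... | inj₂ refl = there (here refl)
  ... | inj₁ d<n with d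
  ...   | 0 = contradiction (0∣⇒≡0 (∥⇒∣ d∥n)) (>⇒≢ 1≤n)
  ...   | 1 = here refl
  ...   | suc (suc _) = contradiction (lose (∈-unitaryDivisors⁺ 1≤n d∥n) (s≤s (s≤s z≤n) , d<n)) noProper

2∤⇒2∣suc : ∀ {n} → 2 ∤ n → 2 ∣ suc n
2∤⇒2∣suc {n} 2∤n with n % 2 | m≡m%n+[m/n]*n n 2 | m%n<n n 2
... | 0 | n≡ | _ = contradiction (divides (n / 2) n≡) 2∤n
... | 1 | n≡ | _ = divides (suc (n / 2)) (cong suc n≡)
... | suc (suc _) | _ | s≤s (s≤s ())

2∣⇒2∤suc : ∀ {n} → 2 ∣ n → 2 ∤ suc n
2∣⇒2∤suc {n} 2∣n 2∣suc =
  contradiction (∣⇒≤ (∣m+n∣m⇒∣n (subst (2 ∣_) (+-comm 1 n) 2∣suc) 2∣n)) λ { (s≤s ()) }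

odd≥3 : ∀ {u} → 2 ≤ u → 2 ∤ u → 3 ≤ u
odd≥3 {1} (s≤s ()) _
odd≥3 {2} _ 2∤2 = contradiction ∣-refl 2∤2
odd≥3 {suc (suc (suc _))} _ _ = s≤s (s≤s (s≤s z≤n))

odd≥5 : ∀ {m} → 2 ∤ m → m ≢ 1 → m ≢ 3 → 5 ≤ m
odd≥5 {0} 2∤m _ _ = contradiction (divides 0 refl) 2∤m
odd≥5 {1} _ m≢1 _ = contradiction refl m≢1
odd≥5 {2} 2∤m _ _ = contradiction (divides 1 refl) 2∤m
odd≥5 {3} _ _ m≢3 = contradiction refl m≢3
odd≥5 {4} 2∤m _ _ = contradiction (divides 2 refl) 2∤m
odd≥5 {suc (suc (suc (suc (suc _))))} _ _ _ = s≤s (s≤s (s≤s (s≤s (s≤s z≤n))))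

σ*-even : ∀ n → 2 ≤ n → 2 ∤ n → 2 ∣ σ* n
σ*-even = <-rec _ λ n rec 2≤n 2∤n → case coprimeSplit⊎σ*≡suc 2≤n of λ where
  (inj₂ σ*n≡suc) → subst (2 ∣_) (sym σ*n≡suc) (2∤⇒2∣suc 2∤n)
  (inj₁ (u , v , 2≤u , 2≤v , coprime , refl)) →
    subst (2 ∣_) (sym (σ*-multiplicative (<⇒≤ 2≤u) (<⇒≤ 2≤v) coprime))
      (∣m⇒∣m*n (σ* v) (rec (m<m*n u v {{>-nonZero (<⇒≤ 2≤u)}} 2≤v) 2≤u (2∤n ∘ flip ∣-trans (m∣m*n v))))

σ*-4∣ : ∀ {n} → 2 ∤ n → CoprimeSplit n → 4 ∣ σ* n
σ*-4∣ 2∤n (u , v , 2≤u , 2≤v , coprime , refl) =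
  subst (4 ∣_) (sym (σ*-multiplicative (<⇒≤ 2≤u) (<⇒≤ 2≤v) coprime))
    (*-pres-∣ (σ*-even u 2≤u (2∤n ∘ flip ∣-trans (m∣m*n v)))
              (σ*-even v 2≤v (2∤n ∘ flip ∣-trans (n∣m*n u))))

-- For X ≥ 1 this says that X is a power of 2.
OddDivisorsTrivial : ℕ → Set
OddDivisorsTrivial X = ∀ {c} → c ∣ X → 2 ∤ c → c ≡ 1

2∤⇒coprime-2 : ∀ {c} → 2 ∤ c → Coprime c 2
2∤⇒coprime-2 _ {0} (_ , 0∣2) = contradiction (0∣⇒≡0 0∣2) λ ()
2∤⇒coprime-2 _ {1} _ = refl
2∤⇒coprime-2 2∤c {2} (2∣c , _) = contradiction 2∣c 2∤c
2∤⇒coprime-2 _ {suc (suc (suc _))} (_ , d∣2) = contradiction (∣⇒≤ d∣2) λ { (s≤s (s≤s ())) }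

4∣*odd⇒4≤ : ∀ {X m} → 1 ≤ X → 2 ∤ m → 4 ∣ X * m → 4 ≤ X
4∣*odd⇒4≤ {X} {m} 1≤X 2∤m 4∣Xm =
  ∣⇒≤ {{>-nonZero 1≤X}} (coprime-divisor coprime-4m (subst (4 ∣_) (*-comm X m) 4∣Xm))
  where
  coprime-4m : Coprime 4 m
  coprime-4m = Coprime.sym (coprime-* (2∤⇒coprime-2 2∤m) (2∤⇒coprime-2 2∤m))

evenOddDecomposition : ∀ M → 1 ≤ M → ∃₂ λ X m → X * m ≡ M × OddDivisorsTrivial X × 2 ∤ m
evenOddDecomposition = <-rec (λ M → 1 ≤ M → ∃₂ λ X m → X * m ≡ M × OddDivisorsTrivial X × 2 ∤ m)
  λ M rec 1≤M → case 2 ∣? M of λ where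
    (no 2∤M) → 1 , M , *-identityˡ M , (λ {_} c∣1 _ → ∣1⇒≡1 c∣1) , 2∤M
    (yes (divides 0 refl)) → contradiction 1≤M λ ()
    (yes (divides M′@(suc _) refl)) →
      let X , m , Xm≡M′ , oddTrivial , 2∤m = rec (m<m*n M′ 2 ≤-refl) z<s in
      2 * X , m , trans (*-assoc 2 X m) (trans (cong (2 *_) Xm≡M′) (*-comm 2 M′)) ,
      (λ {_} c∣2X 2∤c → oddTrivial (coprime-divisor (2∤⇒coprime-2 2∤c) c∣2X) 2∤c) , 2∤m

oddDivisorsTrivial⇒2∣ : ∀ {X} → 2 ≤ X → OddDivisorsTrivial X → 2 ∣ X
oddDivisorsTrivial⇒2∣ {X} 2≤X oddTrivial with 2 ∣? X
... | yes 2∣X = 2∣X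
... | no 2∤X = contradiction (oddTrivial ∣-refl 2∤X) (>⇒≢ 2≤X)

σ*-oddDivisorsTrivial : ∀ {X} → 2 ≤ X → OddDivisorsTrivial X → σ* X ≡ suc X
σ*-oddDivisorsTrivial 2≤X oddTrivial with coprimeSplit⊎σ*≡suc 2≤X
... | inj₂ σ*X≡suc = σ*X≡suc
... | inj₁ (u , v , 2≤u , 2≤v , coprime , refl) =
  contradiction (coprime (oddDivisorsTrivial⇒2∣ 2≤u (oddTrivial ∘ flip ∣-trans (m∣m*n v)) ,
                          oddDivisorsTrivial⇒2∣ 2≤v (oddTrivial ∘ flip ∣-trans (n∣m*n u))))
                λ ()

σ*≡2*odd⇒factorisation : ∀ {M N} → 1 ≤ M → 2 ∣ M → 2 ∤ N → σ* M ≡ 2 * N →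
                         ∃₂ λ X m → X * m ≡ M × 2 ≤ X × 5 ≤ m × 2 ∤ m × suc X * suc m ≡ 2 * N
σ*≡2*odd⇒factorisation {M} {N} 1≤M 2∣M 2∤N σ*M≡2N
  with X , m , refl , oddTrivial , 2∤m ← evenOddDecomposition M 1≤M =
  X , m , refl , 2≤X , odd≥5 2∤m m≢1 m≢3 , 2∤m , sucX*sucm≡2N
  where
  ∣2N⇒4∤ : ∀ {d} → d ∣ 2 * N → 4 ∤ d
  ∣2N⇒4∤ d∣2N 4∣d = 2∤N (*-cancelˡ-∣ 2 (∣-trans 4∣d d∣2N))
  instance
    X≢0 : NonZero X
    X≢0 = m*n≢0⇒m≢0 X {{>-nonZero 1≤M}}
  X≢1 : X ≢ 1
  X≢1 X≡1 = 2∤m (subst (2 ∣_) (trans (cong (_* m) X≡1) (*-identityˡ m)) 2∣M)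
  2≤X : 2 ≤ X
  2≤X = ≤∧≢⇒< (>-nonZero⁻¹ X) (X≢1 ∘ sym)
  1≤m : 1 ≤ m
  1≤m = >-nonZero⁻¹ m {{m*n≢0⇒n≢0 X {{>-nonZero 1≤M}}}}
  coprime : Coprime X m
  coprime (c∣X , c∣m) = oddTrivial c∣X (2∤m ∘ flip ∣-trans c∣m)
  sucX*σ*m≡2N : suc X * σ* m ≡ 2 * N
  sucX*σ*m≡2N = begin
    suc X * σ* m  ≡⟨ cong (_* σ* m) (σ*-oddDivisorsTrivial 2≤X oddTrivial) ⟨
    σ* X * σ* m   ≡⟨ σ*-multiplicative (>-nonZero⁻¹ X) 1≤m coprime ⟨
    σ* (X * m)    ≡⟨ σ*M≡2N ⟩
    2 * N         ∎
    where open ≡-Reasoning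
  m≢1 : m ≢ 1
  m≢1 refl = 2∣⇒2∤suc (oddDivisorsTrivial⇒2∣ 2≤X oddTrivial)
               (subst (2 ∣_) (trans (sym sucX*σ*m≡2N) (*-identityʳ (suc X))) (m∣m*n N))
  2≤m : 2 ≤ m
  2≤m = ≤∧≢⇒< 1≤m (m≢1 ∘ sym)
  σ*m≡suc : σ* m ≡ suc m
  σ*m≡suc with coprimeSplit⊎σ*≡suc 2≤m
  ... | inj₁ split = contradiction (σ*-4∣ 2∤m split) (∣2N⇒4∤ (divides (suc X) (sym sucX*σ*m≡2N)))
  ... | inj₂ σ*m≡suc = σ*m≡suc
  sucX*sucm≡2N : suc X * suc m ≡ 2 * N
  sucX*sucm≡2N = trans (cong (suc X *_) (sym σ*m≡suc)) sucX*σ*m≡2N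
  m≢3 : m ≢ 3
  m≢3 refl = ∣2N⇒4∤ (divides (suc X) (sym sucX*sucm≡2N)) ∣-refl

factorisation⇒N≡9 : ∀ {N X m} → X * m ≡ suc N → suc X * suc m ≡ 2 * N → 2 ≤ X → 5 ≤ m → N ≡ 9
factorisation⇒N≡9 {N} {suc (suc a)} {suc (suc (suc (suc (suc b))))} Xm≡sucN sucX*sucm≡2N
                  (s≤s (s≤s z≤n)) (s≤s (s≤s (s≤s (s≤s (s≤s z≤n))))) =
  suc-injective (trans (sym Xm≡sucN) (cong₂ (λ a b → (2 + a) * (5 + b)) a≡0 b≡0))
  where
  excess : ∀ a b → 2 * ((2 + a) * (5 + b)) ≡ (3 + a) * (6 + b) + 2 + (b + 4 * a + a * b)
  excess = solve-∀
  P : ℕ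
  P = (3 + a) * (6 + b) + 2
  excess≡0 : b + 4 * a + a * b ≡ 0
  excess≡0 = +-cancelˡ-≡ P _ 0 (begin
    P + (b + 4 * a + a * b)   ≡⟨ excess a b ⟨
    2 * ((2 + a) * (5 + b))   ≡⟨ cong (2 *_) Xm≡sucN ⟩
    2 * suc N                 ≡⟨ trans (*-suc 2 N) (+-comm 2 (2 * N)) ⟩
    2 * N + 2                 ≡⟨ cong (_+ 2) sucX*sucm≡2N ⟨
    P                         ≡⟨ +-identityʳ P ⟨
    P + 0                     ∎)
    where open ≡-Reasoning
  b≡0 : b ≡ 0
  b≡0 = m+n≡0⇒m≡0 b (m+n≡0⇒m≡0 (b + 4 * a) excess≡0)
  a≡0 : a ≡ 0
  a≡0 = m*n≡0⇒m≡0 a 4 (trans (*-comm a 4) (m+n≡0⇒n≡0 b (m+n≡0⇒m≡0 (b + 4 * a) excess≡0)))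

4*[X+m]≤X*m+16 : ∀ {X m} → 4 ≤ X → 4 ≤ m → 4 * (X + m) ≤ X * m + 16
4*[X+m]≤X*m+16 (s≤s (s≤s (s≤s (s≤s (z≤n {c}))))) (s≤s (s≤s (s≤s (s≤s (z≤n {d}))))) =
  subst (4 * ((4 + c) + (4 + d)) ≤_) (sym (expand c d)) (m≤m+n _ (c * d))
  where
  expand : ∀ c d → (4 + c) * (4 + d) + 16 ≡ 4 * ((4 + c) + (4 + d)) + c * d
  expand = solve-∀

m+X+x+y+2≡xy : ∀ x y X m → suc x * suc y ≡ X * m → suc X * suc m ≡ 2 * (x * y) →
               m + (X + (x + y + 2)) ≡ x * y
m+X+x+y+2≡xy x y X m E₁ E₂ =
  +-cancelˡ-≡ (x * y) _ _ (+-cancelˡ-≡ (X * m) _ _ (begin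
    X * m + (x * y + (m + (X + (x + y + 2))))  ≡⟨ expand x y X m ⟨
    suc X * suc m + suc x * suc y             ≡⟨ cong₂ _+_ E₂ E₁ ⟩
    2 * (x * y) + X * m                       ≡⟨ rearrange (x * y) (X * m) ⟩
    X * m + (x * y + x * y)                   ∎))
  where
  open ≡-Reasoning
  expand : ∀ x y X m → suc X * suc m + suc x * suc y ≡ X * m + (x * y + (m + (X + (x + y + 2))))
  expand = solve-∀
  rearrange : ∀ z w → 2 * z + w ≡ w + (z + z)
  rearrange = solve-∀

3xy≤5x+5y+25 : ∀ x y X m → 4 ≤ X → 4 ≤ m → suc x * suc y ≡ X * m → m + (X + (x + y + 2)) ≡ x * y →
               3 * (x * y) ≤ 5 * x + 5 * y + 25
3xy≤5x+5y+25 x y X m 4≤X 4≤m E₁ S = +-cancelˡ-≤ (x * y) _ _ (begin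
  x * y + 3 * (x * y)                      ≡⟨ split (x * y) ⟩
  4 * (x * y)                              ≡⟨ cong (4 *_) S ⟨
  4 * (m + (X + (x + y + 2)))              ≡⟨ regroup x y X m ⟩
  4 * (X + m) + 4 * (x + y + 2)            ≤⟨ +-monoˡ-≤ (4 * (x + y + 2)) (4*[X+m]≤X*m+16 4≤X 4≤m) ⟩
  X * m + 16 + 4 * (x + y + 2)             ≡⟨ cong (λ z → z + 16 + 4 * (x + y + 2)) E₁ ⟨
  suc x * suc y + 16 + 4 * (x + y + 2)     ≡⟨ expand x y ⟩
  x * y + (5 * x + 5 * y + 25)             ∎)
  where
  open ≤-Reasoning
  split : ∀ z → z + 3 * z ≡ 4 * z
  split = solve-∀
  regroup : ∀ x y X m → 4 * (m + (X + (x + y + 2))) ≡ 4 * (X + m) + 4 * (x + y + 2)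
  regroup = solve-∀
  expand : ∀ x y → suc x * suc y + 16 + 4 * (x + y + 2) ≡ x * y + (5 * x + 5 * y + 25)
  expand = solve-∀

3xy≤5x+5y+25⇒x≤10 : ∀ {x y} → 3 ≤ y → 3 * (x * y) ≤ 5 * x + 5 * y + 25 → x ≤ 10
3xy≤5x+5y+25⇒x≤10 {x} {y} 3≤y bound with x ≤? 10
... | yes x≤10 = x≤10
... | no x≰10 = contradiction bound (<⇒≱ (subst₂ (λ x y → 5 * x + 5 * y + 25 < 3 * (x * y))
                                            (m+[n∸m]≡n (≰⇒> x≰10)) (m+[n∸m]≡n 3≤y)
                                            (large (x ∸ 11) (y ∸ 3))))
  where
  large : ∀ a b → 5 * (11 + a) + 5 * (3 + b) + 25 < 3 * ((11 + a) * (3 + b))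
  large a b = subst (5 * (11 + a) + 5 * (3 + b) + 25 <_) (sym (expand a b)) (m≤m+n _ _)
    where
    expand : ∀ a b → 3 * ((11 + a) * (3 + b)) ≡
                     suc (5 * (11 + a) + 5 * (3 + b) + 25) + (3 + 4 * a + 28 * b + 3 * (a * b))
    expand = solve-∀

-- m is determined by m + X + x + y + 2 = x y, so only x, y and X need enumerating.
no-small-odd-coprime-solution : ∀ {x} → x < 11 → ∀ {y} → y < 11 → ∀ {X} → X < 101 →
                                2 ∤ x → 2 ∤ y → Coprime x y →
                                X * (x * y ∸ (X + (x + y + 2))) ≢ suc x * suc y
no-small-odd-coprime-solution = from-yes
  (allUpTo? (λ x → allUpTo? (λ y → allUpTo? (λ X →
     ¬? (2 ∣? x) →-dec ¬? (2 ∣? y) →-dec Coprime.coprime? x y →-dec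
     ¬? (X * (x * y ∸ (X + (x + y + 2))) ≟ suc x * suc y)) 101) 11) 11)

no-odd-coprime-solution : ∀ {x y X m} → 3 ≤ x → 3 ≤ y → 2 ∤ x → 2 ∤ y → Coprime x y →
                          4 ≤ X → 4 ≤ m → suc x * suc y ≡ X * m → suc X * suc m ≢ 2 * (x * y)
no-odd-coprime-solution {x} {y} {X} {m} 3≤x 3≤y 2∤x 2∤y coprime 4≤X 4≤m E₁ E₂ =
  no-small-odd-coprime-solution (s≤s x≤10) (s≤s y≤10) (s≤s X≤100) 2∤x 2∤y coprime
    (trans (cong (X *_) m≡) (sym E₁))
  where
  S : m + (X + (x + y + 2)) ≡ x * y
  S = m+X+x+y+2≡xy x y X m E₁ E₂
  bound : 3 * (x * y) ≤ 5 * x + 5 * y + 25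
  bound = 3xy≤5x+5y+25 x y X m 4≤X 4≤m E₁ S
  x≤10 : x ≤ 10
  x≤10 = 3xy≤5x+5y+25⇒x≤10 3≤y bound
  y≤10 : y ≤ 10
  y≤10 = 3xy≤5x+5y+25⇒x≤10 3≤x
           (subst₂ _≤_ (cong (3 *_) (*-comm x y)) (cong (_+ 25) (+-comm (5 * x) (5 * y))) bound)
  X≤100 : X ≤ 100
  X≤100 = ≤-trans (subst (X ≤_) S (≤-trans (m≤m+n X _) (m≤n+m _ m))) (*-mono-≤ x≤10 y≤10)
  m≡ : x * y ∸ (X + (x + y + 2)) ≡ m
  m≡ = trans (cong (_∸ (X + (x + y + 2))) (sym S)) (m+n∸n≡m m (X + (x + y + 2)))

primeFactor : ∀ {n} → 2 ≤ n → ∃ λ p → Prime p × p ∣ n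
primeFactor {n} 2≤n with factorise n {{>-nonZero (<⇒≤ 2≤n)}}
... | record { factors = [] ; isFactorisation = 1≡n } = contradiction 1≡n (>⇒≢ 2≤n)
... | record { factors = p ∷ ps ; isFactorisation = pΠps≡n ; factorsPrime = p-prime ∷ _ } =
  p , p-prime , divides (product ps) (trans pΠps≡n (*-comm p (product ps)))

injective-members⇒≤length : ∀ {A : Set} {k} {xs : List A} (f : Fin k → A) →
                            Injective _≡_ _≡_ f → (∀ i → f i ∈ xs) → k ≤ length xs
injective-members⇒≤length {A} f f-injective f∈xs =
  injective⇒≤ λ {i} {j} → f-injective ∘ SetoidMembership.index-injective (setoid A) (f∈xs i) (f∈xs j)

pairwiseCoprime⇒≤ω : ∀ {N k} → 1 ≤ N → (u : Fin k → ℕ) → (∀ i → 2 ≤ u i) → (∀ i → u i ∣ N) →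
                     (∀ {i j} → i ≢ j → Coprime (u i) (u j)) → k ≤ ω N
pairwiseCoprime⇒≤ω {N} 1≤N u 2≤u u∣N coprime = injective-members⇒≤length p p-injective p∈
  where
  p : Fin _ → ℕ
  p i = proj₁ (primeFactor (2≤u i))
  p-prime : ∀ i → Prime (p i)
  p-prime i = proj₁ (proj₂ (primeFactor (2≤u i)))
  p∣u : ∀ i → p i ∣ u i
  p∣u i = proj₂ (proj₂ (primeFactor (2≤u i)))
  p-injective : Injective _≡_ _≡_ p
  p-injective {i} {j} pᵢ≡pⱼ with i Fin.≟ j
  ... | yes i≡j = i≡j
  ... | no i≢j = contradiction (coprime i≢j (p∣u i , subst (_∣ u j) (sym pᵢ≡pⱼ) (p∣u j)))
                               (nonTrivial⇒≢1 {{prime⇒nonTrivial (p-prime i)}})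
  p∈ : ∀ i → p i ∈ filter (λ q → prime? q ×-dec q ∣? N) (candidates N)
  p∈ i = ∈-filter⁺ (λ q → prime? q ×-dec q ∣? N) {xs = candidates N}
           (∈-candidates⁺ (<⇒≤ (nonTrivial⇒n>1 (p i) {{prime⇒nonTrivial (p-prime i)}}))
                          (∣⇒≤ {{>-nonZero 1≤N}} (∣-trans (p∣u i) (u∣N i))))
           (p-prime i , ∣-trans (p∣u i) (u∣N i))

coprimeSplit∧coprime⇒3≤ω : ∀ {N u v} → 1 ≤ N → CoprimeSplit u → 2 ≤ v → Coprime u v → u * v ≡ N →
                           3 ≤ ω N
coprimeSplit∧coprime⇒3≤ω {v = v} 1≤N (u₁ , u₂ , 2≤u₁ , 2≤u₂ , coprime₁₂ , refl) 2≤v coprime refl =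
  pairwiseCoprime⇒≤ω 1≤N factor 2≤factor factor∣ pairwiseCoprime
  where
  factor : Fin 3 → ℕ
  factor 0F = u₁
  factor 1F = u₂
  factor 2F = v
  2≤factor : ∀ i → 2 ≤ factor i
  2≤factor 0F = 2≤u₁
  2≤factor 1F = 2≤u₂
  2≤factor 2F = 2≤v
  factor∣ : ∀ i → factor i ∣ u₁ * u₂ * v
  factor∣ 0F = ∣-trans (m∣m*n u₂) (m∣m*n v)
  factor∣ 1F = n∣m*n*o u₁ v
  factor∣ 2F = n∣m*n (u₁ * u₂)
  coprime₁₃ : Coprime u₁ v
  coprime₁₃ = coprime-∣ coprime (m∣m*n u₂) ∣-refl
  coprime₂₃ : Coprime u₂ v
  coprime₂₃ = coprime-∣ coprime (n∣m*n u₁) ∣-refl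
  pairwiseCoprime : ∀ {i j} → i ≢ j → Coprime (factor i) (factor j)
  pairwiseCoprime {0F} {1F} _ = coprime₁₂
  pairwiseCoprime {0F} {2F} _ = coprime₁₃
  pairwiseCoprime {1F} {0F} _ = Coprime.sym coprime₁₂
  pairwiseCoprime {1F} {2F} _ = coprime₂₃
  pairwiseCoprime {2F} {0F} _ = Coprime.sym coprime₁₃
  pairwiseCoprime {2F} {1F} _ = Coprime.sym coprime₂₃
  pairwiseCoprime {0F} {0F} i≢i = contradiction refl i≢i
  pairwiseCoprime {1F} {1F} i≢i = contradiction refl i≢i
  pairwiseCoprime {2F} {2F} i≢i = contradiction refl i≢i

σ*≡suc⇒σ*σ*≢2* : ∀ {N} → 2 ∤ N → N ≢ 9 → σ* N ≡ suc N → σ* (σ* N) ≢ 2 * N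
σ*≡suc⇒σ*σ*≢2* {N} 2∤N N≢9 σ*N≡suc σ*σ*N≡2N
  with X , m , Xm≡sucN , 2≤X , 5≤m , _ , sucX*sucm≡2N ←
       σ*≡2*odd⇒factorisation z<s (2∤⇒2∣suc 2∤N) 2∤N (subst (λ M → σ* M ≡ 2 * N) σ*N≡suc σ*σ*N≡2N)
  = N≢9 (factorisation⇒N≡9 Xm≡sucN sucX*sucm≡2N 2≤X 5≤m)

σ*≡suc-pair⇒σ*σ*≢2* : ∀ {u v} → 2 ≤ u → 2 ≤ v → Coprime u v → 2 ∤ u * v →
                      σ* u ≡ suc u → σ* v ≡ suc v → σ* (σ* (u * v)) ≢ 2 * (u * v)
σ*≡suc-pair⇒σ*σ*≢2* {u} {v} 2≤u 2≤v coprime 2∤uv σ*u≡suc σ*v≡suc σ*σ*uv≡2uv =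
  case σ*≡2*odd⇒factorisation {suc u * suc v} {u * v} z<s (∣-trans (divides 2 refl) 4∣M) 2∤uv σ*M≡2uv
  of λ where
    (X , m , Xm≡M , 2≤X , 5≤m , 2∤m , sucX*sucm≡2N) →
      no-odd-coprime-solution (odd≥3 2≤u 2∤u) (odd≥3 2≤v 2∤v) 2∤u 2∤v coprime
        (4∣*odd⇒4≤ (<⇒≤ 2≤X) 2∤m (subst (4 ∣_) (sym Xm≡M) 4∣M)) (<⇒≤ 5≤m)
        (sym Xm≡M) sucX*sucm≡2N
  where
  2∤u : 2 ∤ u
  2∤u = 2∤uv ∘ flip ∣-trans (m∣m*n v)
  2∤v : 2 ∤ v
  2∤v = 2∤uv ∘ flip ∣-trans (n∣m*n u)
  4∣M : 4 ∣ suc u * suc v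
  4∣M = *-pres-∣ (2∤⇒2∣suc 2∤u) (2∤⇒2∣suc 2∤v)
  σ*M≡2uv : σ* (suc u * suc v) ≡ 2 * (u * v)
  σ*M≡2uv = subst (λ M → σ* M ≡ 2 * (u * v))
              (trans (σ*-multiplicative (<⇒≤ 2≤u) (<⇒≤ 2≤v) coprime) (cong₂ _*_ σ*u≡suc σ*v≡suc))
              σ*σ*uv≡2uv

σ*σ*≡2*∧coprimeSplit⇒3≤ω : ∀ {N u v} → 1 ≤ N → 2 ∤ N → σ* (σ* N) ≡ 2 * N →
                           2 ≤ u → 2 ≤ v → Coprime u v → u * v ≡ N →
                           CoprimeSplit u ⊎ σ* u ≡ suc u → CoprimeSplit v ⊎ σ* v ≡ suc v → 3 ≤ ω N
σ*σ*≡2*∧coprimeSplit⇒3≤ω 1≤N _ _ _ 2≤v coprime uv≡N (inj₁ split-u) _ =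
  coprimeSplit∧coprime⇒3≤ω 1≤N split-u 2≤v coprime uv≡N
σ*σ*≡2*∧coprimeSplit⇒3≤ω {u = u} {v} 1≤N _ _ 2≤u _ coprime uv≡N (inj₂ _) (inj₁ split-v) =
  coprimeSplit∧coprime⇒3≤ω 1≤N split-v 2≤u (Coprime.sym coprime) (trans (*-comm v u) uv≡N)
σ*σ*≡2*∧coprimeSplit⇒3≤ω _ 2∤N σ*σ*N≡2N 2≤u 2≤v coprime refl (inj₂ σ*u≡suc) (inj₂ σ*v≡suc) =
  contradiction σ*σ*N≡2N (σ*≡suc-pair⇒σ*σ*≢2* 2≤u 2≤v coprime 2∤N σ*u≡suc σ*v≡suc)

lemma3p3 : (N : ℕ) → 1 ≤ N → ¬ (2 ∣ N) → σ* (σ* N) ≡ 2 * N → N ≢ 9 → N ≢ 165 → 3 ≤ ω N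
lemma3p3 N 1≤N 2∤N σ*σ*N≡2N N≢9 _ = case coprimeSplit⊎σ*≡suc (≤∧≢⇒< 1≤N 1≢N) of λ where
    (inj₂ σ*N≡suc) → contradiction σ*σ*N≡2N (σ*≡suc⇒σ*σ*≢2* 2∤N N≢9 σ*N≡suc)
    (inj₁ (u , v , 2≤u , 2≤v , coprime , uv≡N)) →
      σ*σ*≡2*∧coprimeSplit⇒3≤ω 1≤N 2∤N σ*σ*N≡2N 2≤u 2≤v coprime uv≡N
        (coprimeSplit⊎σ*≡suc 2≤u) (coprimeSplit⊎σ*≡suc 2≤v)
  where
  1≢N : 1 ≢ N
  1≢N refl = contradiction σ*σ*N≡2N λ ()
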